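{- For any nonempty graphs $F$ and $G$ without isolated vertices and any $n$, $$\mathrm{ex}_F(n,G)\ge \frac{1}{e(F)}\bigl(\mathrm{ex}(n,G)-\mathrm{ex}(n,F)\bigr).$$
   Context: All graphs are simple; $e(F)$ is the number of edges of $F$. $\mathrm{ex}(n,H)$ is the maximum number of edges of an $n$-vertex graph with no subgraph isomorphic to $H$. $\mathrm{ex}_F(n,G)$ is the maximum $k$ such that there exist $k$ pairwise edge-disjoint subgraphs $F_1,\dots,F_k$ of $K_n$, each isomorphic to $F$, such that $\bigcup_i F_i$ contains no subgraph $G'$ isomorphic to $G$ with $|E(G')\cap E(F_i)|\le 1$ for every $i$. -}

module Defs where

open import Data.Nat using (ℕ; _+_; _*_; _≤_; _<_; _<ᵇ_)
open import Data.Bool using (Bool; true; false; _∧_; if_then_else_)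
open import Data.Fin using (Fin; toℕ)
open import Data.List using (List; map; allFin)
open import Data.Nat.ListAction using (sum)
open import Data.Product using (Σ; ∃; _×_; _,_)
open import Relation.Binary.PropositionalEquality using (_≡_; _≢_)
open import Function.Definitions using (Injective)

record SGraph (v : ℕ) : Set where
  field
    adj    : Fin v → Fin v → Bool
    sym    : ∀ x y → adj x y ≡ adj y x
    irrefl : ∀ x → adj x x ≡ false
open SGraph public

record Graph : Set where
  constructor graph
  field
    V  : ℕ
    gr : SGraph V
open Graph public

countPairs : ∀ {v} → (Fin v → Fin v → Bool) → ℕ
countPairs {v} r =
  sum (map (λ x → sum (map (λ y → if (toℕ x <ᵇ toℕ y) ∧ r x y then 1 else 0) (allFin v))) (allFin v))

e : Graph → ℕ
e F = countPairs (adj (gr F))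

eS : ∀ {v} → SGraph v → ℕ
eS H = countPairs (adj H)

NonEmpty : Graph → Set
NonEmpty F = 0 < e F

NoIsolated : Graph → Set
NoIsolated F = ∀ (a : Fin (V F)) → ∃ λ b → adj (gr F) a b ≡ true

ContainsCopy : ∀ {n} → SGraph n → Graph → Set
ContainsCopy {n} H F =
  Σ (Fin (V F) → Fin n) λ φ → Injective _≡_ _≡_ φ ×
    (∀ a b → adj (gr F) a b ≡ true → adj H (φ a) (φ b) ≡ true)

-- The subgraph of K_n with edge set H is isomorphic to F (F without isolated
-- vertices, so the subgraph is determined by its edge set): the edges of H are
-- exactly the images of the edges of F under an injective vertex map.
IsCopyOf : ∀ {n} → SGraph n → Graph → Set
IsCopyOf {n} H F =
  Σ (Fin (V F) → Fin n) λ φ → Injective _≡_ _≡_ φ ×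
    (∀ x y → (adj H x y ≡ true →
                ∃ λ a → ∃ λ b → φ a ≡ x × φ b ≡ y × adj (gr F) a b ≡ true)
           × (∀ a b → φ a ≡ x → φ b ≡ y → adj (gr F) a b ≡ true → adj H x y ≡ true))

IsMax : (ℕ → Set) → ℕ → Set
IsMax P m = P m × (∀ k → P k → k ≤ m)

ExAchieved : ℕ → Graph → ℕ → Set
ExAchieved n H m = Σ (SGraph n) λ K → (ContainsCopy K H → Data.Empty.⊥) × eS K ≡ m
  where import Data.Empty

IsEx : ℕ → Graph → ℕ → Set
IsEx n H = IsMax (ExAchieved n H)

GoodFamily : ℕ → Graph → Graph → ℕ → Set
GoodFamily n F G k =
  Σ (Fin k → SGraph n) λ Fs →
    (∀ i → IsCopyOf (Fs i) F) ×
    (∀ i j → i ≢ j → ∀ x y → adj (Fs i) x y ≡ true → adj (Fs j) x y ≡ false) ×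
    (∀ (G' : SGraph n) → IsCopyOf G' G →
       (∀ x y → adj G' x y ≡ true → ∃ λ i → adj (Fs i) x y ≡ true) →
       (∀ i → countPairs (λ x y → adj G' x y ∧ adj (Fs i) x y) ≤ 1) →
       Data.Empty.⊥)
  where import Data.Empty

IsExF : ℕ → Graph → Graph → ℕ → Set
IsExF n F G = IsMax (GoodFamily n F G)

-- Start from an n-vertex G-free graph K with ex(n,G) edges and greedily delete
-- the edges of copies of F, one copy at a time, until the remainder is F-free.
-- The deleted copies are pairwise edge-disjoint and their union lies inside the
-- G-free graph K, so they form an admissible family for ex_F(n,G): if there are
-- k of them then k ≤ ex_F(n,G). Each copy takes away at most e(F) edges and the
-- F-free remainder keeps at most ex(n,F), so ex(n,G) ≤ e(F) k + ex(n,F).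
-- Containment of F is not decided constructively, so the greedy packing exists
-- only up to double negation; this suffices because the inequality is decidable.
module Submission where

open import Defs hiding (sym)
open import Data.Nat using (ℕ; zero; suc; _+_; _*_; _≤_; _<_; _<ᵇ_; z≤n; z<s; _≤?_; _<?_)
open import Data.Nat.Properties
open import Data.Nat.Induction using (<-wellFounded)
import Data.Nat.ListAction as List
open import Data.Bool using (Bool; true; false; _∧_; not; if_then_else_)
open import Data.Bool.Properties using (¬-not; not-¬) renaming (_≟_ to _≟ᵇ_)
open import Data.Fin as Fin using (Fin; toℕ)
import Data.Fin.Properties as Finₚ
open import Data.List using (map; allFin; tabulate)
open import Data.List.Properties using (map-tabulate)
open import Data.Product using (Σ; ∃; ∃₂; _×_; _,_; proj₂)
open import Data.Empty using (⊥-elim)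
open import Function.Base using (_∘_)
open import Function.Definitions using (Injective)
open import Algebra.Properties.Semiring.Sum +-*-semiring
  using (sum; sum-syntax; ∑-distrib-+; ∑-comm; sum-cong-≗; sum-replicate-zero; *-distribˡ-sum; *-distribʳ-sum)
open import Induction.WellFounded using (module All)
import Relation.Binary.Construct.On as On
open import Relation.Binary.Definitions using (tri<; tri≈; tri>)
open import Relation.Binary.PropositionalEquality
open import Relation.Nullary using (¬_; Dec; does; yes; no; _×-dec_)
open import Relation.Nullary.Decidable using (dec-true; dec-false; decidable-stable)
open import Relation.Nullary.Negation using (¬¬-map)

private
  variable
    m n v : ℕ

𝟙 : Bool → ℕ
𝟙 b = if b then 1 else 0

𝟙-pos : ∀ {b} → 0 < 𝟙 b → b ≡ true
𝟙-pos {true} _ = refl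

sum-allFin : (f : Fin n → ℕ) → List.sum (map f (allFin n)) ≡ sum f
sum-allFin f = trans (cong List.sum (map-tabulate (λ i → i) f)) (sum-tabulate f)
  where
  sum-tabulate : ∀ {n} (f : Fin n → ℕ) → List.sum (tabulate f) ≡ sum f
  sum-tabulate {zero} f = refl
  sum-tabulate {suc n} f = cong (f Fin.zero +_) (sum-tabulate (f ∘ Fin.suc))

sum-mono-≤ : {f g : Fin n → ℕ} → (∀ i → f i ≤ g i) → sum f ≤ sum g
sum-mono-≤ {zero} f≤g = z≤n
sum-mono-≤ {suc n} f≤g = +-mono-≤ (f≤g Fin.zero) (sum-mono-≤ (f≤g ∘ Fin.suc))

≤-sum : (f : Fin n → ℕ) (i : Fin n) → f i ≤ sum f
≤-sum f Fin.zero = m≤m+n _ _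
≤-sum f (Fin.suc i) = ≤-trans (≤-sum (f ∘ Fin.suc) i) (m≤n+m _ (f Fin.zero))

sum-pos : (f : Fin n → ℕ) → 0 < sum f → ∃ λ i → 0 < f i
sum-pos {suc n} f pos with f Fin.zero in eq
... | suc _ = Fin.zero , subst (0 <_) (sym eq) z<s
... | zero with sum-pos (f ∘ Fin.suc) pos
... | i , fi>0 = Fin.suc i , fi>0

∑² : (Fin v → Fin v → ℕ) → ℕ
∑² {v} f = ∑[ x < v ] ∑[ y < v ] f x y

∑²-distrib-+ : (f g : Fin v → Fin v → ℕ) → ∑² (λ x y → f x y + g x y) ≡ ∑² f + ∑² g
∑²-distrib-+ f g = trans (sum-cong-≗ (λ x → ∑-distrib-+ (f x) (g x)))
                         (∑-distrib-+ (λ x → sum (f x)) (λ x → sum (g x)))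

∑²-mono-≤ : {f g : Fin v → Fin v → ℕ} → (∀ x y → f x y ≤ g x y) → ∑² f ≤ ∑² g
∑²-mono-≤ f≤g = sum-mono-≤ (λ x → sum-mono-≤ (f≤g x))

≤-∑² : (f : Fin v → Fin v → ℕ) (x y : Fin v) → f x y ≤ ∑² f
≤-∑² f x y = ≤-trans (≤-sum (f x) y) (≤-sum (λ x → sum (f x)) x)

∑²-pos : (f : Fin v → Fin v → ℕ) → 0 < ∑² f → ∃₂ λ x y → 0 < f x y
∑²-pos f pos with sum-pos _ pos
... | x , pos′ with sum-pos (f x) pos′
... | y , fxy>0 = x , y , fxy>0

∑²-comm : (f : Fin m → Fin m → Fin n → Fin n → ℕ) →
          ∑² (λ x y → ∑² (f x y)) ≡ ∑² (λ a b → ∑² (λ x y → f x y a b))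
∑²-comm f = begin
  ∑[ x < _ ] ∑[ y < _ ] ∑[ a < _ ] ∑[ b < _ ] f x y a b
    ≡⟨ sum-cong-≗ (λ x → ∑-comm (λ y a → sum (f x y a))) ⟩
  ∑[ x < _ ] ∑[ a < _ ] ∑[ y < _ ] ∑[ b < _ ] f x y a b
    ≡⟨ ∑-comm (λ x a → ∑[ y < _ ] sum (f x y a)) ⟩
  ∑[ a < _ ] ∑[ x < _ ] ∑[ y < _ ] ∑[ b < _ ] f x y a b
    ≡⟨ sum-cong-≗ (λ a → sum-cong-≗ (λ x → ∑-comm (λ y b → f x y a b))) ⟩
  ∑[ a < _ ] ∑[ x < _ ] ∑[ b < _ ] ∑[ y < _ ] f x y a b
    ≡⟨ sum-cong-≗ (λ a → ∑-comm (λ x b → ∑[ y < _ ] f x y a b)) ⟩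
  ∑[ a < _ ] ∑[ b < _ ] ∑[ x < _ ] ∑[ y < _ ] f x y a b ∎
  where open ≡-Reasoning

δ : Fin v → Fin v → ℕ
δ u x = 𝟙 (does (u Finₚ.≟ x))

δ-refl : (u : Fin v) → δ u u ≡ 1
δ-refl u = cong 𝟙 (dec-true (u Finₚ.≟ u) refl)

sum-δ : (u : Fin v) → sum (δ u) ≡ 1
sum-δ {suc v} Fin.zero = cong suc (sum-replicate-zero v)
sum-δ (Fin.suc u) = sum-δ u

sum-δ-* : (u : Fin v) (c : ℕ) → ∑[ x < v ] (δ u x * c) ≡ c
sum-δ-* u c = begin
  ∑[ x < _ ] (δ u x * c) ≡⟨ *-distribʳ-sum c (δ u) ⟨
  sum (δ u) * c          ≡⟨ cong (_* c) (sum-δ u) ⟩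
  1 * c                  ≡⟨ *-identityˡ c ⟩
  c                      ∎
  where open ≡-Reasoning

∑²-δ : (u w : Fin v) (c : ℕ) → ∑² (λ x y → δ u x * (δ w y * c)) ≡ c
∑²-δ u w c = begin
  ∑[ x < _ ] ∑[ y < _ ] (δ u x * (δ w y * c)) ≡⟨ sum-cong-≗ (λ x → *-distribˡ-sum (δ u x) (λ y → δ w y * c)) ⟨
  ∑[ x < _ ] (δ u x * ∑[ y < _ ] (δ w y * c)) ≡⟨ sum-cong-≗ (λ x → cong (δ u x *_) (sum-δ-* w c)) ⟩
  ∑[ x < _ ] (δ u x * c)                      ≡⟨ sum-δ-* u c ⟩
  c                                           ∎
  where open ≡-Reasoning

countOrdered : (Fin v → Fin v → Bool) → ℕ
countOrdered r = ∑² (λ x y → 𝟙 (r x y))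

countOrdered-pos : (r : Fin v → Fin v → Bool) → 0 < countOrdered r → ∃₂ λ x y → r x y ≡ true
countOrdered-pos r pos with ∑²-pos _ pos
... | x , y , rxy>0 = x , y , 𝟙-pos rxy>0

edge⇒countOrdered-pos : (r : Fin v → Fin v → Bool) {x y : Fin v} → r x y ≡ true → 0 < countOrdered r
edge⇒countOrdered-pos r {x} {y} rxy = ≤-trans (≤-reflexive (cong 𝟙 (sym rxy))) (≤-∑² _ x y)

upperEdge : (Fin v → Fin v → Bool) → Fin v → Fin v → ℕ
upperEdge r x y = 𝟙 ((toℕ x <ᵇ toℕ y) ∧ r x y)

countPairs≡∑² : (r : Fin v → Fin v → Bool) → countPairs r ≡ ∑² (upperEdge r)
countPairs≡∑² {v} r = trans (sum-allFin {v} _) (sum-cong-≗ (λ x → sum-allFin (upperEdge r x)))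

<ᵇ-true : ∀ {i j} → i < j → (i <ᵇ j) ≡ true
<ᵇ-true {i} {j} = dec-true (i <? j)

<ᵇ-false : ∀ {i j} → j ≤ i → (i <ᵇ j) ≡ false
<ᵇ-false {i} {j} j≤i = dec-false (i <? j) (≤⇒≯ j≤i)

𝟙-adj-split : (H : SGraph v) (x y : Fin v) →
              𝟙 (adj H x y) ≡ upperEdge (adj H) x y + upperEdge (adj H) y x
𝟙-adj-split H x y with Finₚ.<-cmp x y
... | tri< x<y _ _ rewrite <ᵇ-true x<y | <ᵇ-false (<⇒≤ x<y) = sym (+-identityʳ _)
... | tri> _ _ y<x rewrite <ᵇ-true y<x | <ᵇ-false (<⇒≤ y<x) = cong 𝟙 (SGraph.sym H x y)
... | tri≈ _ refl _ rewrite <ᵇ-false (≤-refl {toℕ x}) | irrefl H x = refl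

countOrdered≡2*eS : (H : SGraph v) → countOrdered (adj H) ≡ 2 * eS H
countOrdered≡2*eS H = begin
  countOrdered (adj H)
    ≡⟨ sum-cong-≗ (λ x → sum-cong-≗ (𝟙-adj-split H x)) ⟩
  ∑² (λ x y → P x y + P y x)
    ≡⟨ ∑²-distrib-+ P (λ x y → P y x) ⟩
  ∑² P + ∑² (λ x y → P y x)
    ≡⟨ cong (∑² P +_) (∑-comm (λ x y → P y x)) ⟩
  ∑² P + ∑² P
    ≡⟨ cong₂ _+_ (countPairs≡∑² (adj H)) (trans (+-identityʳ _) (countPairs≡∑² (adj H))) ⟨
  2 * eS H ∎
  where
  open ≡-Reasoning
  P : Fin _ → Fin _ → ℕ
  P = upperEdge (adj H)

eS-pos : (H : SGraph v) → 0 < eS H → ∃₂ λ x y → adj H x y ≡ true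
eS-pos H pos = countOrdered-pos (adj H) (subst (0 <_) (sym (countOrdered≡2*eS H)) (*-monoʳ-< 2 pos))

edge⇒eS-pos : (H : SGraph v) {x y : Fin v} → adj H x y ≡ true → 0 < eS H
edge⇒eS-pos H xy = *-cancelˡ-< 2 0 (eS H) (subst (0 <_) (countOrdered≡2*eS H) (edge⇒countOrdered-pos (adj H) xy))

_⊆_ : SGraph v → SGraph v → Set
H ⊆ K = ∀ x y → adj H x y ≡ true → adj K x y ≡ true

_∖_ : SGraph v → SGraph v → SGraph v
K ∖ C = record
  { adj = λ x y → adj K x y ∧ not (adj C x y)
  ; sym = λ x y → cong₂ (λ p q → p ∧ not q) (SGraph.sym K x y) (SGraph.sym C x y)
  ; irrefl = λ x → cong (_∧ not (adj C x x)) (irrefl K x)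
  }

∖-⊆ : (K C : SGraph v) → (K ∖ C) ⊆ K
∖-⊆ K C x y h with adj K x y
... | true = refl

∖-disjoint : (K C : SGraph v) (x y : Fin v) → adj (K ∖ C) x y ≡ true → adj C x y ≡ false
∖-disjoint K C x y h with adj K x y | adj C x y
... | true | false = refl

𝟙-∧-split : ∀ l k c → (c ≡ true → k ≡ true) → 𝟙 (l ∧ k) ≡ 𝟙 (l ∧ (k ∧ not c)) + 𝟙 (l ∧ c)
𝟙-∧-split false k     c     _   = refl
𝟙-∧-split true  true  false _   = refl
𝟙-∧-split true  false false _   = refl
𝟙-∧-split true  true  true  _   = refl
𝟙-∧-split true  false true  c⇒k with () ← c⇒k refl

eS-∖ : (K C : SGraph v) → C ⊆ K → eS K ≡ eS (K ∖ C) + eS C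
eS-∖ K C C⊆K = begin
  eS K                                          ≡⟨ countPairs≡∑² (adj K) ⟩
  ∑² (E K)                                      ≡⟨ sum-cong-≗ (λ x → sum-cong-≗ (split x)) ⟩
  ∑² (λ x y → E (K ∖ C) x y + E C x y)          ≡⟨ ∑²-distrib-+ (E (K ∖ C)) (E C) ⟩
  ∑² (E (K ∖ C)) + ∑² (E C)                     ≡⟨ cong₂ _+_ (countPairs≡∑² (adj (K ∖ C))) (countPairs≡∑² (adj C)) ⟨
  eS (K ∖ C) + eS C                             ∎
  where
  open ≡-Reasoning
  E : SGraph _ → Fin _ → Fin _ → ℕ
  E H = upperEdge (adj H)
  split : ∀ x y → E K x y ≡ E (K ∖ C) x y + E C x y
  split x y = 𝟙-∧-split (toℕ x <ᵇ toℕ y) (adj K x y) (adj C x y) (C⊆K x y)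

module _ (φ : Fin m → Fin n) where

  ImageEdge : (Fin m → Fin m → Bool) → Fin n → Fin n → Set
  ImageEdge r x y = ∃₂ λ a b → φ a ≡ x × φ b ≡ y × r a b ≡ true

  imageEdge? : (r : Fin m → Fin m → Bool) (x y : Fin n) → Dec (ImageEdge r x y)
  imageEdge? r x y =
    Finₚ.any? λ a → Finₚ.any? λ b → (φ a Finₚ.≟ x) ×-dec (φ b Finₚ.≟ y) ×-dec (r a b ≟ᵇ true)

  -- Double counting: each image pair (x, y) is charged to a preimage edge (a, b)
  -- through the point masses δ (φ a) x · δ (φ b) y.
  countOrdered-image-≤ : (r : Fin m → Fin m → Bool) →
                         countOrdered (λ x y → does (imageEdge? r x y)) ≤ countOrdered r
  countOrdered-image-≤ r = begin
    countOrdered (λ x y → does (imageEdge? r x y)) ≤⟨ ∑²-mono-≤ charge ⟩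
    ∑² (λ x y → ∑² (λ a b → T a b x y))          ≡⟨ ∑²-comm (λ x y a b → T a b x y) ⟩
    ∑² (λ a b → ∑² (T a b))                      ≡⟨ sum-cong-≗ (λ a → sum-cong-≗ (λ b → ∑²-δ (φ a) (φ b) _)) ⟩
    countOrdered r                               ∎
    where
    open ≤-Reasoning
    T : Fin m → Fin m → Fin n → Fin n → ℕ
    T a b x y = δ (φ a) x * (δ (φ b) y * 𝟙 (r a b))
    charge : ∀ x y → 𝟙 (does (imageEdge? r x y)) ≤ ∑² (λ a b → T a b x y)
    charge x y with imageEdge? r x y
    ... | no _ = z≤n
    ... | yes (a , b , refl , refl , rab) =
      ≤-trans (≤-reflexive (sym charged)) (≤-∑² (λ a′ b′ → T a′ b′ (φ a) (φ b)) a b)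
      where
      charged : T a b (φ a) (φ b) ≡ 1
      charged rewrite δ-refl (φ a) | δ-refl (φ b) | rab = refl

  module _ (inj : Injective _≡_ _≡_ φ) where

    image : SGraph m → SGraph n
    image H = record
      { adj = λ x y → does (imageEdge? (adj H) x y)
      ; sym = λ x y → symmetric x y
      ; irrefl = λ x → dec-false (imageEdge? (adj H) x x) loopless
      }
      where
      flip-edge : ∀ {x y} → ImageEdge (adj H) x y → ImageEdge (adj H) y x
      flip-edge (a , b , p , q , h) = b , a , q , p , trans (SGraph.sym H b a) h
      symmetric : ∀ x y → does (imageEdge? (adj H) x y) ≡ does (imageEdge? (adj H) y x)
      symmetric x y with imageEdge? (adj H) x y | imageEdge? (adj H) y x
      ... | yes _ | yes _ = refl
      ... | no _  | no _  = refl
      ... | yes e | no ¬e = ⊥-elim (¬e (flip-edge e))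
      ... | no ¬e | yes e = ⊥-elim (¬e (flip-edge e))
      loopless : ∀ {x} → ¬ ImageEdge (adj H) x x
      loopless (a , b , p , q , h) with inj (trans p (sym q))
      ... | refl with () ← trans (sym (irrefl H a)) h

    image-adj⁺ : (H : SGraph m) {x y : Fin n} → ImageEdge (adj H) x y → adj (image H) x y ≡ true
    image-adj⁺ H = dec-true (imageEdge? (adj H) _ _)

    image-adj⁻ : (H : SGraph m) {x y : Fin n} → adj (image H) x y ≡ true → ImageEdge (adj H) x y
    image-adj⁻ H {x} {y} h with imageEdge? (adj H) x y
    ... | yes e = e

    eS-image-≤ : (H : SGraph m) → eS (image H) ≤ eS H
    eS-image-≤ H = *-cancelˡ-≤ 2 (subst₂ _≤_ (countOrdered≡2*eS (image H)) (countOrdered≡2*eS H)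
                                          (countOrdered-image-≤ (adj H)))

    eS-image-pos : (H : SGraph m) → 0 < eS H → 0 < eS (image H)
    eS-image-pos H pos with eS-pos H pos
    ... | a , b , hab = edge⇒eS-pos (image H) (image-adj⁺ H (a , b , refl , refl , hab))

    image-⊆ : (H : SGraph m) (K : SGraph n) → (∀ a b → adj H a b ≡ true → adj K (φ a) (φ b) ≡ true) → image H ⊆ K
    image-⊆ H K pres x y h with image-adj⁻ H h
    ... | a , b , refl , refl , hab = pres a b hab

image-isCopyOf : (F : Graph) (φ : Fin (V F) → Fin n) (inj : Injective _≡_ _≡_ φ) →
                 IsCopyOf (image φ inj (gr F)) F
image-isCopyOf F φ inj =
  φ , inj , λ x y → image-adj⁻ φ inj (gr F) , λ a b p q h → image-adj⁺ φ inj (gr F) (a , b , p , q , h)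

record Packing (F : Graph) (K : SGraph n) (k : ℕ) : Set where
  field
    copy     : Fin k → SGraph n
    isCopy   : ∀ i → IsCopyOf (copy i) F
    disjoint : ∀ i j → i ≢ j → ∀ x y → adj (copy i) x y ≡ true → adj (copy j) x y ≡ false
    inside   : ∀ i → copy i ⊆ K

emptyPacking : (F : Graph) (K : SGraph n) → Packing F K 0
emptyPacking F K = record { copy = λ () ; isCopy = λ () ; disjoint = λ () ; inside = λ () }

extendPacking : {F : Graph} {K C : SGraph n} {k : ℕ} → C ⊆ K → IsCopyOf C F →
                Packing F (K ∖ C) k → Packing F K (suc k)
extendPacking {F = F} {K} {C} C⊆K C≅F P = record
  { copy = copy′ ; isCopy = isCopy′ ; disjoint = disjoint′ ; inside = inside′ }
  where
  open Packing P
  copy′ : Fin (suc _) → SGraph _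
  copy′ Fin.zero = C
  copy′ (Fin.suc i) = copy i
  isCopy′ : ∀ i → IsCopyOf (copy′ i) F
  isCopy′ Fin.zero = C≅F
  isCopy′ (Fin.suc i) = isCopy i
  off-C : ∀ i x y → adj (copy i) x y ≡ true → adj C x y ≡ false
  off-C i x y h = ∖-disjoint K C x y (inside i x y h)
  disjoint′ : ∀ i j → i ≢ j → ∀ x y → adj (copy′ i) x y ≡ true → adj (copy′ j) x y ≡ false
  disjoint′ Fin.zero Fin.zero i≢j = ⊥-elim (i≢j refl)
  disjoint′ Fin.zero (Fin.suc j) _ x y h = ¬-not λ hj → not-¬ h (off-C j x y hj)
  disjoint′ (Fin.suc i) Fin.zero _ x y h = off-C i x y h
  disjoint′ (Fin.suc i) (Fin.suc j) i≢j = disjoint i j (i≢j ∘ cong Fin.suc)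
  inside′ : ∀ i → copy′ i ⊆ K
  inside′ Fin.zero = C⊆K
  inside′ (Fin.suc i) x y h = ∖-⊆ K C x y (inside i x y h)

copyOfSubgraph : (F : Graph) (K : SGraph n) → NonEmpty F → ContainsCopy K F →
                 Σ (SGraph n) λ C → C ⊆ K × IsCopyOf C F × 0 < eS C × eS C ≤ e F
copyOfSubgraph F K nonEmpty (φ , inj , pres) =
  image φ inj (gr F) , image-⊆ φ inj (gr F) K pres , image-isCopyOf F φ inj ,
  eS-image-pos φ inj (gr F) nonEmpty , eS-image-≤ φ inj (gr F)

-- The G-freeness of the host graph makes the condition |E(G') ∩ E(F_i)| ≤ 1 superfluous.
Packing⇒GoodFamily : {F G : Graph} {K : SGraph n} {k : ℕ} → ¬ ContainsCopy K G → Packing F K k →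
                     GoodFamily n F G k
Packing⇒GoodFamily {G = G} {K} G-free P =
  copy , isCopy , disjoint , λ G′ G′≅G covered _ → G-free (embed G′ G′≅G covered)
  where
  open Packing P
  embed : ∀ G′ → IsCopyOf G′ G → (∀ x y → adj G′ x y ≡ true → ∃ λ i → adj (copy i) x y ≡ true) →
          ContainsCopy K G
  embed G′ (ψ , inj , edges) covered = ψ , inj , λ a b hab →
    let i , h = covered (ψ a) (ψ b) (proj₂ (edges (ψ a) (ψ b)) a b refl refl hab)
    in inside i (ψ a) (ψ b) h

module _ (F : Graph) (nonEmpty : NonEmpty F) {n b : ℕ} (exF-bound : ∀ k → ExAchieved n F k → k ≤ b) where

  EfficientPacking : SGraph n → Set
  EfficientPacking K = ∃ λ k → Packing F K k × eS K ≤ e F * k + b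

  efficientPacking : ∀ K → ¬ ¬ EfficientPacking K
  efficientPacking = All.wfRec (On.wellFounded eS <-wellFounded) _ _ step
    where
    step : ∀ K → (∀ {K′} → eS K′ < eS K → ¬ ¬ EfficientPacking K′) → ¬ ¬ EfficientPacking K
    step K ih ¬packing =
      ¬packing (0 , emptyPacking F K , ≤-trans F-free-bound (≤-reflexive (cong (_+ b) (sym (*-zeroʳ (e F))))))
      where
      F-free : ¬ ContainsCopy K F
      F-free K⊇F with copyOfSubgraph F K nonEmpty K⊇F
      ... | C , C⊆K , C≅F , eC>0 , eC≤eF = ih smaller (¬packing ∘ extend)
        where
        split : eS K ≡ eS (K ∖ C) + eS C
        split = eS-∖ K C C⊆K
        smaller : eS (K ∖ C) < eS K
        smaller = subst (eS (K ∖ C) <_) (sym split) (m<m+n _ eC>0)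
        extend : EfficientPacking (K ∖ C) → EfficientPacking K
        extend (k , P , bound) = suc k , extendPacking {K = K} {C} C⊆K C≅F P , (begin
          eS K                      ≡⟨ split ⟩
          eS (K ∖ C) + eS C         ≤⟨ +-mono-≤ bound eC≤eF ⟩
          e F * k + b + e F         ≡⟨ +-comm _ (e F) ⟩
          e F + (e F * k + b)       ≡⟨ +-assoc (e F) _ b ⟨
          e F + e F * k + b         ≡⟨ cong (_+ b) (*-suc (e F) k) ⟨
          e F * suc k + b           ∎)
          where open ≤-Reasoning
      F-free-bound : eS K ≤ b
      F-free-bound = exF-bound (eS K) (K , F-free , refl)

proposition2 : (F G : Graph) → NonEmpty F → NoIsolated F → NonEmpty G → NoIsolated G →
    (n a b c : ℕ) → IsEx n G a → IsEx n F b → IsExF n F G c →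
    a ≤ e F * c + b
-- Neither isolated vertices nor the nonemptiness of G matter for this bound.
proposition2 F G nonEmpty _ _ _ n a b c ((K₀ , G-free , refl) , _) (_ , exF-bound) (_ , exFG-bound) =
  decidable-stable (a ≤? e F * c + b) (¬¬-map bound (efficientPacking F nonEmpty exF-bound K₀))
  where
  bound : EfficientPacking F nonEmpty exF-bound K₀ → eS K₀ ≤ e F * c + b
  bound (k , P , eK₀≤) =
    ≤-trans eK₀≤ (+-monoˡ-≤ b (*-monoʳ-≤ (e F) (exFG-bound k (Packing⇒GoodFamily {G = G} {K₀} G-free P))))
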